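{- Let $\emptyset\neq\mathcal{T}\subset\Sigma_\$^+$ be a finite indexed family with total length $n$. Then for each $i\in[1..n]$, $\mathrm{F}_\mathcal{T}[i]=\pi(\mathrm{conj}(\mathrm{CA}[i]))$ and $\mathrm{L}_\mathcal{T}[i]=\mathrm{RTS}(\mathrm{conj}(\mathrm{CA}[i]))[\,|\mathrm{conj}(\mathrm{CA}[i])|\,]$.
   Context: $\Sigma=[0..\sigma]$ integer alphabet, $\$\notin\Sigma$ smaller than every integer, $\Sigma_\$=\Sigma\cup\{\$\}$, $\infty$ larger than every integer. Strings 1-indexed; $X[..i]=X[1..i]$, $X[i..]=X[i..|X|]$; $X^\omega$ infinite concatenation. Every nonempty $X$ is $Y^k$ for a unique primitive $Y=:\mathrm{root}(X)$. $\mathrm{rot}^0(X)=X$, $\mathrm{rot}^{k+1}(X)=\mathrm{rot}^k(X)[2..]\cdot\mathrm{rot}^k(X)[1]$. $U<V$ iff $U$ is a proper prefix of $V$ or $U[\ell+1]<V[\ell+1]$ with $\ell$ the longest common prefix length. $\mathrm{rank}_c(X,j)$ = occurrences of $c$ in $X[1..j]$. $\mathrm{PD}(V)[i]=\infty$ if $V[i]\neq\$$ and $V[i]<V[j]$ for all $j<i$; $=\$$ if $V[i]=\$$; otherwise $i-\max\{j<i:V[j]\le V[i]\}$. $\mathrm{RPD}(V)=\mathrm{PD}(V^2)[|V|+1..]$. $V\preceq_\omega U$ iff some natural $i$ has $\mathrm{PD}(V^\omega[..i])<\mathrm{PD}(U^\omega[..i])$ or $\mathrm{root}(\mathrm{RPD}(V))=\mathrm{root}(\mathrm{RPD}(U))$;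 $=_\omega$: both directions; $\prec_\omega$: $\preceq_\omega$ and not $=_\omega$. Write $\mathcal{T}=\{T_1,\dots,T_d\}$, $n_k=|T_k|$; for $i\in[1..n]$, $j$ minimal with $n_1+\dots+n_j\ge i$, $\mathrm{conj}(i)=\mathrm{rot}^{\,i-1-(n_1+\dots+n_{j-1})}(T_j)$. $\mathrm{CA}[i]=j$ iff $i-1=|\{k:\mathrm{conj}(k)\prec_\omega\mathrm{conj}(j)\text{ or }(\mathrm{conj}(k)=_\omega\mathrm{conj}(j)\wedge k<j)\}|$, $\mathrm{ICA}=\mathrm{CA}^{ -1}$; $\mathrm{prev}(i)=i-1+|\mathrm{root}(\mathrm{RPD}(T_j))|$ if $\mathrm{conj}(i)=_\omega T_j$, else $i-1$; $\mathrm{LF}[i]=\mathrm{ICA}[\mathrm{prev}(\mathrm{CA}[i])]$. $\mathrm{RTS}(V)[i]=\$$ if $V[i]=\$$, else $\mathrm{rank}_\infty(\mathrm{PD}(\mathrm{rot}^i(V)),|V|)-\mathrm{rank}_\infty(\mathrm{PD}(V[i]\cdot\mathrm{rot}^i(V))[2..],|V|)$; $\pi(V)=\mathrm{RTS}(V)[1]$. $\mathrm{L}_\mathcal{T}[i]=\pi(\mathrm{conj}(\mathrm{CA}[\mathrm{LF}[i]]))$ and $\mathrm{F}_\mathcal{T}$ is defined by $\mathrm{F}_\mathcal{T}[\mathrm{LF}[i]]=\mathrm{L}_\mathcal{T}[i]$ for all $i$. -}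

module Defs where

open import Data.Nat using (ℕ; zero; suc; _+_; _*_; _∸_; _≤_; _<_; _≤ᵇ_; _<ᵇ_; _≡ᵇ_)
open import Data.Integer as ℤ using (ℤ; +_)
open import Data.Bool using (Bool; true; false; if_then_else_; _∧_)
open import Data.List using (List; []; _∷_; _++_; [_]; length; take; drop; map; upTo)
open import Data.Bool.ListAction using (any)
open import Data.Nat.ListAction using (sum)
open import Data.List.Relation.Unary.Unique.Propositional using (Unique)
open import Data.List.Membership.Propositional using (_∈_)
open import Data.Maybe using (Maybe; just; nothing)
open import Data.Product using (Σ; _×_; ∃)
open import Data.Sum using (_⊎_)
open import Relation.Nullary using (¬_)
open import Relation.Unary using (Pred)
open import Relation.Binary.PropositionalEquality using (_≡_)
open import Function.Bundles using (_⇔_)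

data Sym : Set where
  $  : Sym
  ch : ℕ → Sym

data InΣ$ (σ : ℕ) : Sym → Set where
  dollar : InΣ$ σ $
  letter : ∀ {a} → a ≤ σ → InΣ$ σ (ch a)

_≤ˢ_ : Sym → Sym → Bool
$    ≤ˢ _    = true
ch _ ≤ˢ $    = false
ch a ≤ˢ ch b = a ≤ᵇ b

data PDSym : Set where
  ∞   : PDSym
  $p  : PDSym
  num : ℕ → PDSym

data _<ᵖ_ : PDSym → PDSym → Set where
  $<num : ∀ {m} → $p <ᵖ num m
  $<∞   : $p <ᵖ ∞
  num<∞ : ∀ {m} → num m <ᵖ ∞
  num<num : ∀ {m k} → m < k → num m <ᵖ num k

_==ᵖ_ : PDSym → PDSym → Bool
∞     ==ᵖ ∞     = true
$p    ==ᵖ $p    = true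
num m ==ᵖ num k = m ≡ᵇ k
_     ==ᵖ _     = false

eqList : List PDSym → List PDSym → Bool
eqList []       []       = true
eqList (x ∷ xs) (y ∷ ys) = (x ==ᵖ y) ∧ eqList xs ys
eqList _        _        = false

isInf : PDSym → Bool
isInf ∞ = true
isInf _ = false

data _<ˡ_ : List PDSym → List PDSym → Set where
  prefix : ∀ {y ys} → [] <ˡ (y ∷ ys)
  here   : ∀ {x y xs ys} → x <ᵖ y → (x ∷ xs) <ˡ (y ∷ ys)
  there  : ∀ {x xs ys} → xs <ˡ ys → (x ∷ xs) <ˡ (x ∷ ys)

-- Basic string operations (1-indexed lookup)

at : {A : Set} → List A → ℕ → Maybe A
at []       _             = nothing
at (x ∷ xs) zero          = nothing
at (x ∷ xs) (suc zero)    = just x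
at (x ∷ xs) (suc (suc i)) = at xs (suc i)

pow : {A : Set} → List A → ℕ → List A
pow X zero    = []
pow X (suc k) = X ++ pow X k

omegaPrefix : {A : Set} → List A → ℕ → List A
omegaPrefix X i = take i (pow X i)

rot : {A : Set} → List A → List A
rot []       = []
rot (x ∷ xs) = xs ++ [ x ]

rotN : {A : Set} → ℕ → List A → List A
rotN zero    X = X
rotN (suc k) X = rot (rotN k X)

-- PD(V): position i gets $ if V[i]=$, ∞ if V[i] < V[j] for all j<i,
-- otherwise i - max{ j < i : V[j] ≤ V[i] }.

-- distance to the nearest previous symbol ≤ x; `rev` is the reversed prefix
pdDist : Sym → List Sym → ℕ → PDSym
pdDist x []        k = ∞
pdDist x (y ∷ rev) k = if y ≤ˢ x then num k else pdDist x rev (suc k)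

pdEntry : Sym → List Sym → PDSym
pdEntry $        rev = $p
pdEntry (ch a)   rev = pdDist (ch a) rev 1

pdGo : List Sym → List Sym → List PDSym
pdGo rev []       = []
pdGo rev (x ∷ xs) = pdEntry x rev ∷ pdGo (x ∷ rev) xs

PD : List Sym → List PDSym
PD V = pdGo [] V

RPD : List Sym → List PDSym
RPD V = drop (length V) (PD (V ++ V))

-- root(X): the primitive root, computed as the shortest nonempty prefix
-- P of X such that X = P^k for some k (for X = [] we return []).

isPowerOf : List PDSym → List PDSym → Bool
isPowerOf P X = any (λ k → eqList (pow P k) X) (upTo (suc (length X)))

firstPow : List PDSym → List (List PDSym) → List PDSym
firstPow X []       = X
firstPow X (P ∷ Ps) = if isPowerOf P X then P else firstPow X Ps

root : List PDSym → List PDSym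
root X = firstPow X (map (λ p → take p X) (drop 1 (upTo (suc (length X)))))

_⪯ω_ : List Sym → List Sym → Set
V ⪯ω U = (∃ λ i → PD (omegaPrefix V i) <ˡ PD (omegaPrefix U i))
         ⊎ (root (RPD V) ≡ root (RPD U))

_=ω_ : List Sym → List Sym → Set
V =ω U = (V ⪯ω U) × (U ⪯ω V)

_≺ω_ : List Sym → List Sym → Set
V ≺ω U = (V ⪯ω U) × ¬ (V =ω U)

-- Families, conjugates (positions 1-indexed in [1..n])

totalLen : List (List Sym) → ℕ
totalLen T = sum (map length T)

conj : List (List Sym) → ℕ → List Sym
conj []       i = []
conj (t ∷ ts) i = if i ≤ᵇ length t then rotN (i ∸ 1) t else conj ts (i ∸ length t)

strOf : List (List Sym) → ℕ → List Sym
strOf []       i = []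
strOf (t ∷ ts) i = if i ≤ᵇ length t then t else strOf ts (i ∸ length t)

InRange : ℕ → ℕ → Set
InRange n i = (1 ≤ i) × (i ≤ n)

CardIs : ℕ → Pred ℕ _ → ℕ → Set
CardIs n P m = Σ (List ℕ) λ xs →
  Unique xs × (∀ k → (k ∈ xs) ⇔ (InRange n k × P k)) × (length xs ≡ m)

CASpec : List (List Sym) → (ℕ → ℕ) → Set
CASpec T CA =
  (∀ i → InRange (totalLen T) i → InRange (totalLen T) (CA i)) ×
  (∀ i j → InRange (totalLen T) i → InRange (totalLen T) j →
     (CA i ≡ j) ⇔
     CardIs (totalLen T)
       (λ k → (conj T k ≺ω conj T j) ⊎ ((conj T k =ω conj T j) × (k < j)))
       (i ∸ 1))

ICASpec : ℕ → (ℕ → ℕ) → (ℕ → ℕ) → Set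
ICASpec n CA ICA =
  (∀ j → InRange n j → InRange n (ICA j)) ×
  (∀ i j → InRange n i → InRange n j → (ICA j ≡ i) ⇔ (CA i ≡ j))

PrevSpec : List (List Sym) → (ℕ → ℕ) → Set
PrevSpec T prev = ∀ i → InRange (totalLen T) i →
  ((conj T i =ω strOf T i) → prev i ≡ i ∸ 1 + length (root (RPD (strOf T i)))) ×
  (¬ (conj T i =ω strOf T i) → prev i ≡ i ∸ 1)

LF : (CA ICA prev : ℕ → ℕ) → ℕ → ℕ
LF CA ICA prev i = ICA (prev (CA i))

data RSym : Set where
  $r  : RSym
  val : ℤ → RSym

rank∞ : List PDSym → ℕ → ℕ
rank∞ X j = countInf (take j X)
  where
  countInf : List PDSym → ℕ
  countInf []       = 0
  countInf (c ∷ cs) = if isInf c then suc (countInf cs) else countInf cs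

RTS : List Sym → ℕ → RSym
RTS V i with at V i
... | nothing = $r      -- out of range (never used)
... | just $  = $r
... | just x  = val ((+ rank∞ (PD (rotN i V)) (length V))
                     ℤ.- (+ rank∞ (drop 1 (PD (x ∷ rotN i V))) (length V)))

π : List Sym → RSym
π V = RTS V 1

Lt : List (List Sym) → (CA ICA prev : ℕ → ℕ) → ℕ → RSym
Lt T CA ICA prev i = π (conj T (CA (LF CA ICA prev i)))

{-# OPTIONS --safe #-}
-- Let t be a string of the family and p = |root(RPD t)|. RTS(V)[|V|] is a function of RPD(V)
-- alone, and the same function applied to RPD(rot V) gives π(V); as RPD commutes with
-- rotations, π(rot^o′ t) = RTS(rot^o t)[|t|] as soon as rot^(o′+1) and rot^o agree on RPD(t).
-- On the other hand rot^o t =ω t holds exactly when p ∣ o: the strict parts of ⪯ω are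
-- asymmetric, and a rotation of RPD(t) with the same primitive root is a multiple of p
-- (Lyndon–Schützenberger). So prev sends offset o of t to o − 1, or to o + p − 1 when p ∣ o;
-- in both cases rot^(o′+1) and rot^o agree on RPD(t), which gives the identity for L. Moreover
-- prev permutes the offsets of t, so LF = ICA ∘ prev ∘ CA is onto and F[LF i] = L[i] determines F.
module Submission where

open import Defs
open import Data.Nat using (ℕ; _≤_)
open import Data.List using (List; []; length)
open import Data.List.Relation.Unary.All using (All)
open import Data.Product using (_×_)
open import Relation.Binary.PropositionalEquality using (_≡_; _≢_)

open import Data.Bool using (true; false; T; if_then_else_)
open import Data.Bool.Properties using (T-≡; T-∧)
import Data.Integer as ℤ
open import Data.Integer.Properties using ([+m]-[+n]≡m⊖n; ⊖-≥)
open import Data.List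
  using (_∷_; _++_; [_]; _∷ʳ_; _ʳ++_; take; drop; map; reverse; applyUpTo; upTo; last; initLast; _∷ʳ′_)
open import Data.List.Membership.Propositional using (lose)
open import Data.List.Membership.Propositional.Properties using (∈-upTo⁺)
open import Data.List.Properties hiding (sum-++)
open import Data.List.Relation.Unary.All as All using (_∷_)
open import Data.List.Relation.Unary.Any using (Any; here; there; satisfied)
open import Data.List.Relation.Unary.Any.Properties using (any⁺; any⁻; reverse⁺)
open import Data.Maybe using (Maybe; just)
open import Data.Nat
  using (zero; suc; pred; _+_; _*_; _∸_; _⊓_; _<_; _≤ᵇ_; _≡ᵇ_; z≤n; s≤s; z<s; NonZero; ≢-nonZero; >-nonZero; >-nonZero⁻¹)
open import Data.Nat.DivMod using (_%_; _/_; m≡m%n+[m/n]*n; m%n<n)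
open import Data.Nat.ListAction using (sum)
open import Data.Nat.ListAction.Properties using (sum-++)
open import Data.Nat.Divisibility using (_∣_; divides; _∣?_; _∣0; ∣⇒≤; n∣m*n; m%n≡0⇒n∣m; ∣m+n∣m⇒∣n)
open import Data.Nat.Induction using (<-wellFounded)
open import Data.Nat.Properties
open import Algebra.Properties.CommutativeSemigroup +-commutativeSemigroup using (interchange)
open import Data.Product using (∃-syntax; Σ-syntax; _,_; proj₁; proj₂)
open import Data.Sum using (_⊎_; inj₁; inj₂)
open import Data.Unit using (tt)
open import Function using (_∘_)
open import Function.Bundles using (Equivalence)
open import Induction.WellFounded using (Acc; acc)
open import Relation.Nullary using (¬_; yes; no; contradiction)
open import Relation.Binary.PropositionalEquality
  using (refl; sym; trans; cong; cong₂; subst; subst₂; module ≡-Reasoning)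

-- Words, rotations and powers

module _ {A : Set} where

  take-++ˡ : ∀ n (xs : List A) {ys} → n ≤ length xs → take n (xs ++ ys) ≡ take n xs
  take-++ˡ zero    xs       _       = refl
  take-++ˡ (suc n) (x ∷ xs) (s≤s h) = cong (x ∷_) (take-++ˡ n xs h)

  drop-length-++ : ∀ (xs : List A) {ys} → drop (length xs) (xs ++ ys) ≡ ys
  drop-length-++ []       = refl
  drop-length-++ (x ∷ xs) = drop-length-++ xs

  ++≡++⇒prefix : ∀ (u v : List A) {u′ v′} → u ++ u′ ≡ v ++ v′ → length u ≤ length v →
                 ∃[ w ] v ≡ u ++ w
  ++≡++⇒prefix []      v       _  _       = v , refl
  ++≡++⇒prefix (x ∷ u) (y ∷ v) eq (s≤s h) with refl , eq′ ← ∷-injective eq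
    with w , v≡u++w ← ++≡++⇒prefix u v eq′ h = w , cong (x ∷_) v≡u++w

  length≡0⇒≡[] : ∀ {X : List A} → length X ≡ 0 → X ≡ []
  length≡0⇒≡[] {[]} _ = refl

  length-rot : (X : List A) → length (rot X) ≡ length X
  length-rot []      = refl
  length-rot (x ∷ X) = length-++-comm X [ x ]

  length-rotN : ∀ k (X : List A) → length (rotN k X) ≡ length X
  length-rotN zero    X = refl
  length-rotN (suc k) X = trans (length-rot (rotN k X)) (length-rotN k X)

  rotN-≢[] : ∀ k {X : List A} → X ≢ [] → rotN k X ≢ []
  rotN-≢[] k {X} X≢[] eq = X≢[] (length≡0⇒≡[] (trans (sym (length-rotN k X)) (cong length eq)))

  rotN-+ : ∀ a b (X : List A) → rotN (a + b) X ≡ rotN a (rotN b X)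
  rotN-+ zero    b X = refl
  rotN-+ (suc a) b X = cong rot (rotN-+ a b X)

  rotN-++ : ∀ (P Q : List A) → rotN (length P) (P ++ Q) ≡ Q ++ P
  rotN-++ []      Q = sym (++-identityʳ Q)
  rotN-++ (a ∷ P) Q = begin
    rotN (1 + length P) (a ∷ P ++ Q)   ≡⟨ cong (λ k → rotN k (a ∷ P ++ Q)) (+-comm 1 (length P)) ⟩
    rotN (length P + 1) (a ∷ P ++ Q)   ≡⟨ rotN-+ (length P) 1 (a ∷ P ++ Q) ⟩
    rotN (length P) ((P ++ Q) ∷ʳ a)    ≡⟨ cong (rotN (length P)) (++-assoc P Q [ a ]) ⟩
    rotN (length P) (P ++ (Q ∷ʳ a))    ≡⟨ rotN-++ P (Q ∷ʳ a) ⟩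
    (Q ∷ʳ a) ++ P                      ≡⟨ ∷ʳ-++ Q a P ⟩
    Q ++ a ∷ P                         ∎
    where open ≡-Reasoning

  rotN-[] : ∀ k → rotN {A} k [] ≡ []
  rotN-[] zero    = refl
  rotN-[] (suc k) = cong rot (rotN-[] k)

  rotN-length : (X : List A) → rotN (length X) X ≡ X
  rotN-length X = trans (cong (rotN (length X)) (sym (++-identityʳ X))) (rotN-++ X [])

  rotN-*-fixed : ∀ p (X : List A) → rotN p X ≡ X → ∀ q → rotN (q * p) X ≡ X
  rotN-*-fixed p X fixed zero    = refl
  rotN-*-fixed p X fixed (suc q) =
    trans (rotN-+ p (q * p) X) (trans (cong (rotN p) (rotN-*-fixed p X fixed q)) fixed)

  pow-[] : ∀ k → pow {A} [] k ≡ []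
  pow-[] zero    = refl
  pow-[] (suc k) = pow-[] k

  length-pow : ∀ (P : List A) k → length (pow P k) ≡ k * length P
  length-pow P zero    = refl
  length-pow P (suc k) = trans (length-++ P) (cong (length P +_) (length-pow P k))

  pow-+ : ∀ (P : List A) a b → pow P a ++ pow P b ≡ pow P (a + b)
  pow-+ P zero    b = refl
  pow-+ P (suc a) b = trans (++-assoc P (pow P a) (pow P b)) (cong (P ++_) (pow-+ P a b))

  pow-comm : ∀ (P : List A) k → pow P k ++ P ≡ P ++ pow P k
  pow-comm P zero    = sym (++-identityʳ P)
  pow-comm P (suc k) = trans (++-assoc P (pow P k) P) (cong (P ++_) (pow-comm P k))

  rotN-pow : ∀ (P : List A) k → rotN (length P) (pow P k) ≡ pow P k
  rotN-pow P zero    = rotN-[] (length P)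
  rotN-pow P (suc k) = trans (rotN-++ P (pow P k)) (pow-comm P k)

  CommonPowers : List A → List A → Set
  CommonPowers u v = Σ[ w ∈ List A ] Σ[ a ∈ ℕ ] Σ[ b ∈ ℕ ] u ≡ pow w a × v ≡ pow w b

  private
    swap : ∀ {u v} → CommonPowers u v → CommonPowers v u
    swap (w , a , b , u≡ , v≡) = w , b , a , v≡ , u≡

    extend : ∀ {u v v₂} → v ≡ u ++ v₂ → CommonPowers u v₂ → CommonPowers u v
    extend v≡u++v₂ (w , a , b , u≡ , v₂≡) =
      w , a , a + b , u≡ , trans v≡u++v₂ (trans (cong₂ _++_ u≡ v₂≡) (pow-+ w a b))

    cancel : ∀ (u : List A) {v v₂} → u ++ v ≡ v ++ u → v ≡ u ++ v₂ → u ++ v₂ ≡ v₂ ++ u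
    cancel u {v} {v₂} comm v≡u++v₂ = ++-cancelˡ u _ _ (begin
      u ++ (u ++ v₂)   ≡⟨ cong (u ++_) v≡u++v₂ ⟨
      u ++ v           ≡⟨ comm ⟩
      v ++ u           ≡⟨ cong (_++ u) v≡u++v₂ ⟩
      (u ++ v₂) ++ u   ≡⟨ ++-assoc u v₂ u ⟩
      u ++ (v₂ ++ u)   ∎)
      where open ≡-Reasoning

    shorter : ∀ x u {v v₂ : List A} → v ≡ (x ∷ u) ++ v₂ → length v₂ < length v
    shorter x u {v₂ = v₂} refl =
      s≤s (≤-trans (m≤n+m (length v₂) (length u)) (≤-reflexive (sym (length-++ u))))

    commute : ∀ u v → Acc _<_ (length u + length v) → u ++ v ≡ v ++ u → CommonPowers u v
    commute []      v _ _ = v , 0 , 1 , refl , sym (++-identityʳ v)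
    commute u@(_ ∷ _) [] _ _ = u , 1 , 0 , sym (++-identityʳ u) , refl
    commute u@(x ∷ u′) v@(y ∷ v′) (acc rs) comm with ≤-total (length u) (length v)
    ... | inj₁ u≤v with v₂ , v≡u++v₂ ← ++≡++⇒prefix u v comm u≤v =
      extend v≡u++v₂ (commute u v₂ (rs (+-monoʳ-< (length u) (shorter x u′ v≡u++v₂)))
                                   (cancel u comm v≡u++v₂))
    ... | inj₂ v≤u with u₂ , u≡v++u₂ ← ++≡++⇒prefix v u (sym comm) v≤u =
      swap (extend u≡v++u₂ (commute v u₂ (rs (subst (_< length u + length v) (+-comm (length u₂) (length v))
                                               (+-monoˡ-< (length v) (shorter y v′ u≡v++u₂))))
                                         (cancel v (sym comm) u≡v++u₂)))

  ++-comm⇒CommonPowers : ∀ u v → u ++ v ≡ v ++ u → CommonPowers u v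
  ++-comm⇒CommonPowers u v = commute u v (<-wellFounded _)

-- Primitive roots

==ᵖ⇒≡ : ∀ x y → T (x ==ᵖ y) → x ≡ y
==ᵖ⇒≡ ∞       ∞       _ = refl
==ᵖ⇒≡ $p      $p      _ = refl
==ᵖ⇒≡ (num m) (num n) h = cong num (≡ᵇ⇒≡ m n h)

==ᵖ-refl : ∀ x → T (x ==ᵖ x)
==ᵖ-refl ∞       = tt
==ᵖ-refl $p      = tt
==ᵖ-refl (num n) = ≡⇒≡ᵇ n n refl

eqList⇒≡ : ∀ X Y → T (eqList X Y) → X ≡ Y
eqList⇒≡ []      []      _ = refl
eqList⇒≡ (x ∷ X) (y ∷ Y) h with x≡y , X≡Y ← Equivalence.to T-∧ h =
  cong₂ _∷_ (==ᵖ⇒≡ x y x≡y) (eqList⇒≡ X Y X≡Y)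

eqList-refl : ∀ X → T (eqList X X)
eqList-refl []      = tt
eqList-refl (x ∷ X) = Equivalence.from T-∧ (==ᵖ-refl x , eqList-refl X)

isPowerOf-sound : ∀ P X → T (isPowerOf P X) → ∃[ k ] pow P k ≡ X
isPowerOf-sound P X h with k , eq ← satisfied (any⁻ _ (upTo (suc (length X))) h) = k , eqList⇒≡ _ _ eq

isPowerOf-complete : ∀ P k → k ≤ length (pow P k) → T (isPowerOf P (pow P k))
isPowerOf-complete P k k≤ = any⁺ _ (lose (∈-upTo⁺ (s≤s k≤)) (eqList-refl (pow P k)))

firstPow-sound : ∀ X Ps → firstPow X Ps ≡ X ⊎ T (isPowerOf (firstPow X Ps) X)
firstPow-sound X []       = inj₁ refl
firstPow-sound X (P ∷ Ps) with isPowerOf P X in eq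
... | true  = inj₂ (Equivalence.from T-≡ eq)
... | false = firstPow-sound X Ps

firstPow-first : ∀ X (g : ℕ → List PDSym) m q → q < m → T (isPowerOf (g q) X) →
                 ∃[ j ] j ≤ q × firstPow X (applyUpTo g m) ≡ g j
firstPow-first X g (suc m) q q<m h with isPowerOf (g 0) X in eq
firstPow-first X g (suc m) q       q<m       h | true  = 0 , z≤n , refl
firstPow-first X g (suc m) zero    _         h | false = contradiction (subst T eq h) λ ()
firstPow-first X g (suc m) (suc q) (s≤s q<m) h | false
  with j , j≤q , eq′ ← firstPow-first X (g ∘ suc) m q q<m h = suc j , s≤s j≤q , eq′

root-pow : ∀ X → ∃[ k ] pow (root X) k ≡ X
root-pow X with firstPow-sound X (map (λ p → take p X) (applyUpTo suc (length X)))
... | inj₁ root≡X = 1 , trans (++-identityʳ (root X)) root≡X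
... | inj₂ h      = isPowerOf-sound (root X) X h

root≢[] : ∀ {X} → X ≢ [] → root X ≢ []
root≢[] {X} X≢[] root≡[] with k , eq ← root-pow X =
  X≢[] (trans (sym eq) (trans (cong (λ P → pow P k) root≡[]) (pow-[] k)))

root-minimal : ∀ (w : List PDSym) c → pow w c ≢ [] → length (root (pow w c)) ≤ length w
root-minimal []      c       ne = contradiction (pow-[] c) ne
root-minimal w       zero    ne = contradiction refl ne
root-minimal w@(x ∷ w′) (suc c) _ =
  bound (firstPow-first X (λ p → take (suc p) X) (length X) (length w′) (length-++-≤ˡ w) w-isRoot)
  where
  X = pow w (suc c)
  w-isRoot : T (isPowerOf (take (length w) X) X)
  w-isRoot = subst (λ P → T (isPowerOf P X))
               (sym (trans (take-++ˡ (length w) w ≤-refl) (take-all (length w) w ≤-refl)))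
               (isPowerOf-complete w (suc c)
                 (subst (suc c ≤_) (sym (length-pow w (suc c))) (m≤m*n (suc c) (length w))))
  bound : ∃[ j ] j ≤ length w′ × firstPow X (applyUpTo (λ p → take (suc p) X) (length X)) ≡ take (suc j) X →
          length (root X) ≤ length w
  bound (j , j≤ , eq) = begin
    length (root X)           ≡⟨ cong (length ∘ firstPow X) (map-applyUpTo suc (λ p → take p X) (length X)) ⟩
    length (firstPow X (applyUpTo (λ p → take (suc p) X) (length X)))
                              ≡⟨ cong length eq ⟩
    length (take (suc j) X)   ≡⟨ length-take (suc j) X ⟩
    suc j ⊓ length X          ≤⟨ m⊓n≤m (suc j) (length X) ⟩
    suc j                     ≤⟨ s≤s j≤ ⟩
    length w                  ∎
    where open ≤-Reasoning

root-length-≤ : ∀ X → X ≢ [] → length (root X) ≤ length X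
root-length-≤ X X≢[] =
  subst (λ Y → length (root Y) ≤ length X) (++-identityʳ X)
        (root-minimal X 1 (λ eq → X≢[] (trans (sym (++-identityʳ X)) eq)))

-- Rotating by r splits X into commuting factors, which are powers of a word of length ≤ r.
rotN-fixed⇒root-≤ : ∀ X r → 0 < r → r ≤ length X → rotN r X ≡ X → length (root X) ≤ r
rotN-fixed⇒root-≤ X r 0<r r≤ fixed = bound (++-comm⇒CommonPowers u v u++v≡v++u)
  where
  u = take r X
  v = drop r X
  length-u : length u ≡ r
  length-u = trans (length-take r X) (m≤n⇒m⊓n≡m r≤)
  u++v≡v++u : u ++ v ≡ v ++ u
  u++v≡v++u = begin
    u ++ v                    ≡⟨ take++drop≡id r X ⟩
    X                         ≡⟨ fixed ⟨
    rotN r X                  ≡⟨ cong (λ k → rotN k X) length-u ⟨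
    rotN (length u) X         ≡⟨ cong (rotN (length u)) (take++drop≡id r X) ⟨
    rotN (length u) (u ++ v)  ≡⟨ rotN-++ u v ⟩
    v ++ u                    ∎
    where open ≡-Reasoning
  X≢[] : X ≢ []
  X≢[] X≡[] = <⇒≱ 0<r (subst (r ≤_) (cong length X≡[]) r≤)
  bound : CommonPowers u v → length (root X) ≤ r
  bound (w , zero , b , u≡ , _) = contradiction (trans (sym length-u) (cong length u≡)) (m<n⇒n≢0 0<r)
  bound (w , a@(suc _) , b , u≡ , v≡) = begin
    length (root X)           ≡⟨ cong (length ∘ root) X≡ ⟩
    length (root (pow w (a + b))) ≤⟨ root-minimal w (a + b) (λ eq → X≢[] (trans X≡ eq)) ⟩
    length w                  ≤⟨ m≤n*m (length w) a ⟩
    a * length w              ≡⟨ trans (sym (length-pow w a)) (trans (cong length (sym u≡)) length-u) ⟩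
    r                         ∎
    where
    open ≤-Reasoning
    X≡ : X ≡ pow w (a + b)
    X≡ = trans (sym (take++drop≡id r X)) (trans (cong₂ _++_ u≡ v≡) (pow-+ w a b))

rotN-root : ∀ X → rotN (length (root X)) X ≡ X
rotN-root X with k , X≡ ← root-pow X =
  subst (λ Y → rotN (length (root X)) Y ≡ Y) X≡ (rotN-pow (root X) k)

root-nonZero : ∀ {X} → X ≢ [] → NonZero (length (root X))
root-nonZero X≢[] = ≢-nonZero (λ len≡0 → root≢[] X≢[] (length≡0⇒≡[] len≡0))

root≡⇒≡ : ∀ X Y → X ≢ [] → root X ≡ root Y → length X ≡ length Y → X ≡ Y
root≡⇒≡ X Y X≢[] same-root same-length with k , X≡ ← root-pow X | l , Y≡ ← root-pow Y =
  trans (sym X≡) (trans (cong (pow (root X)) k≡l) (trans (cong (λ P → pow P l) same-root) Y≡))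
  where
  instance _ = root-nonZero X≢[]
  k≡l : k ≡ l
  k≡l = *-cancelʳ-≡ k l (length (root X)) (begin
    k * length (root X)   ≡⟨ trans (sym (length-pow (root X) k)) (cong length X≡) ⟩
    length X              ≡⟨ same-length ⟩
    length Y              ≡⟨ trans (cong length (sym Y≡)) (length-pow (root Y) l) ⟩
    l * length (root Y)   ≡⟨ cong (λ P → l * length P) same-root ⟨
    l * length (root X)   ∎)
    where open ≡-Reasoning

-- A conjugate with the same root is X itself, and a positive remainder o % p
-- would be a rotation period shorter than the root.
root-rotN≡⇒∣ : ∀ X o → X ≢ [] → root (rotN o X) ≡ root X → length (root X) ∣ o
root-rotN≡⇒∣ X o X≢[] same-root = m%n≡0⇒n∣m o p (no-shorter-period (o % p) (m%n<n o p) fixed-%)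
  where
  p = length (root X)
  instance _ = root-nonZero X≢[]
  fixed-o : rotN o X ≡ X
  fixed-o = root≡⇒≡ (rotN o X) X (rotN-≢[] o X≢[]) same-root (length-rotN o X)
  fixed-% : rotN (o % p) X ≡ X
  fixed-% = begin
    rotN (o % p) X                    ≡⟨ cong (rotN (o % p)) (rotN-*-fixed p X (rotN-root X) (o / p)) ⟨
    rotN (o % p) (rotN (o / p * p) X) ≡⟨ rotN-+ (o % p) (o / p * p) X ⟨
    rotN (o % p + o / p * p) X        ≡⟨ cong (λ k → rotN k X) (m≡m%n+[m/n]*n o p) ⟨
    rotN o X                          ≡⟨ fixed-o ⟩
    X                                 ∎
    where open ≡-Reasoning
  no-shorter-period : ∀ r → r < p → rotN r X ≡ X → r ≡ 0
  no-shorter-period zero    _   _     = refl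
  no-shorter-period (suc r) r<p fixed = contradiction
    (rotN-fixed⇒root-≤ X (suc r) (s≤s z≤n) (≤-trans (<⇒≤ r<p) (root-length-≤ X X≢[])) fixed)
    (<⇒≱ r<p)

-- Previous-smaller distances

_≼_ : Sym → Sym → Set
x ≼ y = T (x ≤ˢ y)

≼-refl : ∀ x → x ≼ x
≼-refl $      = tt
≼-refl (ch a) = ≤⇒≤ᵇ (≤-refl {a})

length-pdGo : ∀ R Y → length (pdGo R Y) ≡ length Y
length-pdGo R []      = refl
length-pdGo R (y ∷ Y) = cong suc (length-pdGo (y ∷ R) Y)

pdGo-++ : ∀ R Y Z → pdGo R (Y ++ Z) ≡ pdGo R Y ++ pdGo (Y ʳ++ R) Z
pdGo-++ R []      Z = refl
pdGo-++ R (y ∷ Y) Z = cong (pdEntry y R ∷_) (pdGo-++ (y ∷ R) Y Z)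

pdGo-take : ∀ R i Y → pdGo R (take i Y) ≡ take i (pdGo R Y)
pdGo-take R zero    Y       = refl
pdGo-take R (suc i) []      = refl
pdGo-take R (suc i) (y ∷ Y) = cong (pdEntry y R ∷_) (pdGo-take (y ∷ R) i Y)

pdDist-++ : ∀ y R S k → Any (_≼ y) R → pdDist y (R ++ S) k ≡ pdDist y R k
pdDist-++ y (r ∷ R) S k r≼y with r ≤ˢ y in eq
... | true  = refl
pdDist-++ y (r ∷ R) S k (here r≼y)  | false = contradiction (subst T eq r≼y) λ ()
pdDist-++ y (r ∷ R) S k (there R∋) | false = pdDist-++ y R S (suc k) R∋

pdEntry-++ : ∀ y R S → Any (_≼ y) R → pdEntry y (R ++ S) ≡ pdEntry y R
pdEntry-++ $      R S _   = refl
pdEntry-++ (ch a) R S R∋ = pdDist-++ (ch a) R S 1 R∋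

-- Symbols older than some symbol ≼ y are never consulted for y.
pdGo-++-history : ∀ R S Y → All (λ y → Any (_≼ y) R) Y → pdGo (R ++ S) Y ≡ pdGo R Y
pdGo-++-history R S []      _           = refl
pdGo-++-history R S (y ∷ Y) (R∋ ∷ R∋s) =
  cong₂ _∷_ (pdEntry-++ y R S R∋) (pdGo-++-history (y ∷ R) S Y (All.map there R∋s))

PD-take : ∀ i Y → PD (take i Y) ≡ take i (PD Y)
PD-take = pdGo-take []

RPD≡pdGo-reverse : ∀ V → RPD V ≡ pdGo (reverse V) V
RPD≡pdGo-reverse V = begin
  drop (length V) (pdGo [] (V ++ V))
    ≡⟨ cong (drop (length V)) (pdGo-++ [] V V) ⟩
  drop (length V) (pdGo [] V ++ pdGo (reverse V) V)
    ≡⟨ cong (λ n → drop n (pdGo [] V ++ pdGo (reverse V) V)) (length-pdGo [] V) ⟨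
  drop (length (pdGo [] V)) (pdGo [] V ++ pdGo (reverse V) V)
    ≡⟨ drop-length-++ (pdGo [] V) ⟩
  pdGo (reverse V) V ∎
  where open ≡-Reasoning

length-RPD : ∀ V → length (RPD V) ≡ length V
length-RPD V = trans (cong length (RPD≡pdGo-reverse V)) (length-pdGo (reverse V) V)

reverse-∷ʳ : ∀ {A : Set} (xs : List A) x → reverse (xs ∷ʳ x) ≡ x ∷ reverse xs
reverse-∷ʳ xs x = ++-ʳ++ xs

ʳ++-assoc : ∀ {A : Set} (xs : List A) {ys zs} → xs ʳ++ (ys ++ zs) ≡ (xs ʳ++ ys) ++ zs
ʳ++-assoc xs {ys} {zs} =
  trans (ʳ++-defn xs) (trans (sym (++-assoc (reverse xs) ys zs)) (cong (_++ zs) (sym (ʳ++-defn xs))))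

RPD-rot : ∀ V → RPD (rot V) ≡ rot (RPD V)
RPD-rot []      = refl
RPD-rot (a ∷ W) = begin
  RPD (W ∷ʳ a)
    ≡⟨ RPD≡pdGo-reverse (W ∷ʳ a) ⟩
  pdGo (reverse (W ∷ʳ a)) (W ∷ʳ a)
    ≡⟨ cong (λ R → pdGo R (W ∷ʳ a)) (reverse-∷ʳ W a) ⟩
  pdGo (a ∷ reverse W) (W ∷ʳ a)
    ≡⟨ pdGo-++ (a ∷ reverse W) W [ a ] ⟩
  pdGo (a ∷ reverse W) W ∷ʳ pdEntry a (W ʳ++ a ∷ reverse W)
    ≡⟨ cong₂ _∷ʳ_ W-entries a-entry ⟨
  pdGo (a ∷ W ʳ++ [ a ]) W ∷ʳ pdEntry a (W ʳ++ [ a ])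
    ≡⟨ cong rot (RPD≡pdGo-reverse (a ∷ W)) ⟨
  rot (RPD (a ∷ W)) ∎
  where
  open ≡-Reasoning
  W-entries : pdGo (a ∷ W ʳ++ [ a ]) W ≡ pdGo (a ∷ reverse W) W
  W-entries = trans (cong (λ R → pdGo (a ∷ R) W) (ʳ++-defn W))
    (pdGo-++-history (a ∷ reverse W) [ a ] W
      (All.tabulate λ {y} y∈W → there (reverse⁺ (lose {P = _≼ y} y∈W (≼-refl y)))))
  a-entry : pdEntry a (W ʳ++ [ a ]) ≡ pdEntry a (W ʳ++ a ∷ reverse W)
  a-entry = sym (trans (cong (pdEntry a) (ʳ++-assoc W))
    (pdEntry-++ a (W ʳ++ [ a ]) (reverse W) (reverse⁺ {xs = a ∷ W} (here (≼-refl a)))))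

RPD-rotN : ∀ k V → RPD (rotN k V) ≡ rotN k (RPD V)
RPD-rotN zero    V = refl
RPD-rotN (suc k) V = trans (RPD-rot (rotN k V)) (cong rot (RPD-rotN k V))

-- RTS at the last position

𝟙∞ : PDSym → ℕ
𝟙∞ ∞       = 1
𝟙∞ $p      = 0
𝟙∞ (num _) = 0

#∞ : List PDSym → ℕ
#∞ []      = 0
#∞ (c ∷ Z) = 𝟙∞ c + #∞ Z

rank∞-length : ∀ Z → rank∞ Z (length Z) ≡ #∞ Z
rank∞-length []          = refl
rank∞-length (∞ ∷ Z)     = cong suc (rank∞-length Z)
rank∞-length ($p ∷ Z)    = rank∞-length Z
rank∞-length (num _ ∷ Z) = rank∞-length Z

𝟙num : ℕ → PDSym → ℕ
𝟙num d (num e) = if e ≡ᵇ d then 1 else 0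
𝟙num d ∞       = 0
𝟙num d $p      = 0

-- #pointingTo d Z counts the entries of Z pointing exactly d positions before the head of Z.
#pointingTo : ℕ → List PDSym → ℕ
#pointingTo d []      = 0
#pointingTo d (c ∷ Z) = 𝟙num d c + #pointingTo (suc d) Z

𝟙num-num-≢ : ∀ {d e} → e ≢ d → 𝟙num d (num e) ≡ 0
𝟙num-num-≢ {d} {e} e≢d with e ≡ᵇ d in eq
... | true  = contradiction (≡ᵇ⇒≡ e d (subst T (sym eq) tt)) e≢d
... | false = refl

𝟙num-num-refl : ∀ d → 𝟙num d (num d) ≡ 1
𝟙num-num-refl d with d ≡ᵇ d | ≡⇒≡ᵇ d d refl
... | true | _ = refl

𝟙num-pdDist : ∀ y S {j} k → j < k → 𝟙num j (pdDist y S k) ≡ 0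
𝟙num-pdDist y []      k _   = refl
𝟙num-pdDist y (s ∷ S) k j<k with s ≤ˢ y
... | true  = 𝟙num-num-≢ (>⇒≢ j<k)
... | false = 𝟙num-pdDist y S (suc k) (m<n⇒m<1+n j<k)

𝟙∞-pdDist-∷ʳ : ∀ y R S x k →
  𝟙∞ (pdDist y R k) ≡ 𝟙∞ (pdDist y (R ∷ʳ x) k) + 𝟙num (k + length R) (pdDist y (R ++ x ∷ S) k)
𝟙∞-pdDist-∷ʳ y [] S x k rewrite +-identityʳ k with x ≤ˢ y
... | true  = sym (𝟙num-num-refl k)
... | false = cong suc (sym (𝟙num-pdDist y S (suc k) ≤-refl))
𝟙∞-pdDist-∷ʳ y (r ∷ R) S x k with r ≤ˢ y
... | true  = sym (𝟙num-num-≢ λ eq → m≢1+m+n k (trans eq (+-suc k (length R))))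
... | false rewrite +-suc k (length R) = 𝟙∞-pdDist-∷ʳ y R S x (suc k)

𝟙∞-pdEntry-∷ʳ : ∀ y R S x →
  𝟙∞ (pdEntry y R) ≡ 𝟙∞ (pdEntry y (R ∷ʳ x)) + 𝟙num (suc (length R)) (pdEntry y (R ++ x ∷ S))
𝟙∞-pdEntry-∷ʳ $      R S x = refl
𝟙∞-pdEntry-∷ʳ (ch a) R S x = 𝟙∞-pdDist-∷ʳ (ch a) R S x 1

-- Making x the oldest symbol of the history turns into pointers to x exactly
-- those ∞ entries that x now bounds; the rest of the history is never reached.
#∞-pdGo-∷ʳ : ∀ Y R S x →
  #∞ (pdGo R Y) ≡ #∞ (pdGo (R ∷ʳ x) Y) + #pointingTo (suc (length R)) (pdGo (R ++ x ∷ S) Y)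
#∞-pdGo-∷ʳ []      R S x = refl
#∞-pdGo-∷ʳ (y ∷ Y) R S x =
  trans (cong₂ _+_ (𝟙∞-pdEntry-∷ʳ y R S x) (#∞-pdGo-∷ʳ Y (y ∷ R) S x))
        (interchange (𝟙∞ (pdEntry y (R ∷ʳ x))) (𝟙num (suc (length R)) (pdEntry y (R ++ x ∷ S)))
                     (#∞ (pdGo (y ∷ R ∷ʳ x) Y)) (#pointingTo (2 + length R) (pdGo (y ∷ R ++ x ∷ S) Y)))

rtsValue : Maybe PDSym → ℕ → RSym
rtsValue (just $p) _ = $r
rtsValue _         g = val (ℤ.+ g)

lastRTS : List PDSym → RSym
lastRTS Z = rtsValue (last Z) (#pointingTo 1 Z)

rtsValue-pdDist : ∀ y R k g → rtsValue (just (pdDist y R k)) g ≡ val (ℤ.+ g)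
rtsValue-pdDist y []      k g = refl
rtsValue-pdDist y (r ∷ R) k g with r ≤ˢ y
... | true  = refl
... | false = rtsValue-pdDist y R (suc k) g

rtsEntry : Sym → List Sym → RSym
rtsEntry $      U = $r
rtsEntry (ch a) U =
  val (ℤ.+ rank∞ (PD U) (length U) ℤ.- ℤ.+ rank∞ (drop 1 (PD (ch a ∷ U))) (length U))

RTS-at : ∀ V i x → at V i ≡ just x → RTS V i ≡ rtsEntry x (rotN i V)
RTS-at V i $      eq rewrite eq = refl
RTS-at V i (ch a) eq rewrite eq | length-rotN i V = refl

last-∷ʳ : ∀ {A : Set} (xs : List A) x → last (xs ∷ʳ x) ≡ just x
last-∷ʳ []           x = refl
last-∷ʳ (_ ∷ [])     x = refl
last-∷ʳ (_ ∷ y ∷ xs) x = last-∷ʳ (y ∷ xs) x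

at-length-∷ʳ : ∀ {A : Set} (xs : List A) x → at (xs ∷ʳ x) (length (xs ∷ʳ x)) ≡ just x
at-length-∷ʳ []           x = refl
at-length-∷ʳ (_ ∷ [])     x = refl
at-length-∷ʳ (_ ∷ y ∷ xs) x = at-length-∷ʳ (y ∷ xs) x

RPD-∷ʳ : ∀ Y x → RPD (Y ∷ʳ x) ≡ pdGo (x ∷ reverse Y) (Y ∷ʳ x)
RPD-∷ʳ Y x = trans (RPD≡pdGo-reverse (Y ∷ʳ x)) (cong (λ R → pdGo R (Y ∷ʳ x)) (reverse-∷ʳ Y x))

last-RPD-∷ʳ : ∀ Y x → last (RPD (Y ∷ʳ x)) ≡ just (pdEntry x (Y ʳ++ x ∷ reverse Y))
last-RPD-∷ʳ Y x =
  trans (cong last (trans (RPD-∷ʳ Y x) (pdGo-++ (x ∷ reverse Y) Y [ x ])))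
        (last-∷ʳ (pdGo (x ∷ reverse Y) Y) _)

+[m+n]-+m≡+n : ∀ m n → ℤ.+ (m + n) ℤ.- ℤ.+ m ≡ ℤ.+ n
+[m+n]-+m≡+n m n =
  trans ([+m]-[+n]≡m⊖n (m + n) m) (trans (⊖-≥ (m≤m+n m n)) (cong ℤ.+_ (m+n∸m≡n m n)))

rtsEntry-∷ʳ : ∀ Y x → rtsEntry x (Y ∷ʳ x) ≡ lastRTS (RPD (Y ∷ʳ x))
rtsEntry-∷ʳ Y $      = cong (λ c → rtsValue c (#pointingTo 1 (RPD (Y ∷ʳ $)))) (sym (last-RPD-∷ʳ Y $))
rtsEntry-∷ʳ Y (ch a) = begin
  val (ℤ.+ rank∞ (pdGo [] V) (length V) ℤ.- ℤ.+ rank∞ (pdGo [ ch a ] V) (length V))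
    ≡⟨ cong₂ (λ m n → val (ℤ.+ m ℤ.- ℤ.+ n)) (rank∞-pdGo []) (rank∞-pdGo [ ch a ]) ⟩
  val (ℤ.+ #∞ (pdGo [] V) ℤ.- ℤ.+ #∞ (pdGo [ ch a ] V))
    ≡⟨ cong (λ m → val (ℤ.+ m ℤ.- ℤ.+ #∞ (pdGo [ ch a ] V))) (#∞-pdGo-∷ʳ V [] (reverse Y) (ch a)) ⟩
  val (ℤ.+ (#∞ (pdGo [ ch a ] V) + #pointingTo 1 Z) ℤ.- ℤ.+ #∞ (pdGo [ ch a ] V))
    ≡⟨ cong val (+[m+n]-+m≡+n (#∞ (pdGo [ ch a ] V)) (#pointingTo 1 Z)) ⟩
  val (ℤ.+ #pointingTo 1 Z)
    ≡⟨ rtsValue-pdDist (ch a) (Y ʳ++ ch a ∷ reverse Y) 1 (#pointingTo 1 Z) ⟨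
  rtsValue (just (pdEntry (ch a) (Y ʳ++ ch a ∷ reverse Y))) (#pointingTo 1 Z)
    ≡⟨ cong₂ rtsValue (last-RPD-∷ʳ Y (ch a)) (cong (#pointingTo 1) (RPD-∷ʳ Y (ch a))) ⟨
  lastRTS (RPD V) ∎
  where
  open ≡-Reasoning
  V = Y ∷ʳ ch a
  Z = pdGo (ch a ∷ reverse Y) V
  rank∞-pdGo : ∀ R → rank∞ (pdGo R V) (length V) ≡ #∞ (pdGo R V)
  rank∞-pdGo R = trans (cong (rank∞ (pdGo R V)) (sym (length-pdGo R V))) (rank∞-length (pdGo R V))

RTS-last : ∀ V → V ≢ [] → RTS V (length V) ≡ lastRTS (RPD V)
RTS-last V V≢[] with initLast V
... | []      = contradiction refl V≢[]
... | Y ∷ʳ′ x = begin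
  RTS (Y ∷ʳ x) (length (Y ∷ʳ x))            ≡⟨ RTS-at (Y ∷ʳ x) (length (Y ∷ʳ x)) x (at-length-∷ʳ Y x) ⟩
  rtsEntry x (rotN (length (Y ∷ʳ x)) (Y ∷ʳ x)) ≡⟨ cong (rtsEntry x) (rotN-length (Y ∷ʳ x)) ⟩
  rtsEntry x (Y ∷ʳ x)                        ≡⟨ rtsEntry-∷ʳ Y x ⟩
  lastRTS (RPD (Y ∷ʳ x))                     ∎
  where open ≡-Reasoning

π≡lastRTS-rot : ∀ V → V ≢ [] → π V ≡ lastRTS (RPD (rot V))
π≡lastRTS-rot []      V≢[] = contradiction refl V≢[]
π≡lastRTS-rot (w ∷ W) _    = trans (RTS-at (w ∷ W) 1 w refl) (rtsEntry-∷ʳ W w)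

-- ω-equality

<ᵖ-irrefl : ∀ {x} → ¬ x <ᵖ x
<ᵖ-irrefl (num<num m<m) = <-irrefl refl m<m

<ᵖ-asym : ∀ {x y} → x <ᵖ y → ¬ y <ᵖ x
<ᵖ-asym (num<num m<n) (num<num n<m) = <-asym m<n n<m

<ˡ-asym : ∀ {A B} → A <ˡ B → ¬ B <ˡ A
<ˡ-asym (here x<y)  (here y<x)  = <ᵖ-asym x<y y<x
<ˡ-asym (here x<x)  (there _)   = <ᵖ-irrefl x<x
<ˡ-asym (there _)   (here x<x)  = <ᵖ-irrefl x<x
<ˡ-asym (there A<B) (there B<A) = <ˡ-asym A<B B<A

<ˡ-take : ∀ i {A B} → length A ≡ length B → take i A <ˡ take i B → A <ˡ B
<ˡ-take (suc i) {x ∷ A} {y ∷ B} _  (here x<y)  = here x<y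
<ˡ-take (suc i) {x ∷ A} {_ ∷ B} eq (there A<B) = there (<ˡ-take i (suc-injective eq) A<B)

module _ {A : Set} where

  length-pow-≥ : ∀ (V : List A) i → V ≢ [] → i ≤ length (pow V i)
  length-pow-≥ []      i V≢[] = contradiction refl V≢[]
  length-pow-≥ (x ∷ V) i _    = subst (i ≤_) (sym (length-pow (x ∷ V) i)) (m≤m*n i (length (x ∷ V)))

  length-omegaPrefix : ∀ (V : List A) i → V ≢ [] → length (omegaPrefix V i) ≡ i
  length-omegaPrefix V i V≢[] = trans (length-take i (pow V i)) (m≤n⇒m⊓n≡m (length-pow-≥ V i V≢[]))

  omegaPrefix-take : ∀ (V : List A) {i j} → V ≢ [] → i ≤ j → take i (omegaPrefix V j) ≡ omegaPrefix V i
  omegaPrefix-take V {i} {j} V≢[] i≤j = begin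
    take i (take j (pow V j))          ≡⟨ take-take i j (pow V j) ⟩
    take (i ⊓ j) (pow V j)             ≡⟨ cong (λ n → take n (pow V j)) (m≤n⇒m⊓n≡m i≤j) ⟩
    take i (pow V j)                   ≡⟨ cong (take i ∘ pow V) (m+[n∸m]≡n i≤j) ⟨
    take i (pow V (i + (j ∸ i)))       ≡⟨ cong (take i) (pow-+ V i (j ∸ i)) ⟨
    take i (pow V i ++ pow V (j ∸ i))  ≡⟨ take-++ˡ i (pow V i) (length-pow-≥ V i V≢[]) ⟩
    take i (pow V i)                   ∎
    where open ≡-Reasoning

PD-omegaPrefix-asym : ∀ {V U i j} → V ≢ [] → U ≢ [] → i ≤ j →
  PD (omegaPrefix V i) <ˡ PD (omegaPrefix U i) → ¬ PD (omegaPrefix U j) <ˡ PD (omegaPrefix V j)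
PD-omegaPrefix-asym {V} {U} {i} {j} V≢[] U≢[] i≤j Vᵢ<Uᵢ =
  <ˡ-asym (<ˡ-take i same-length (subst₂ _<ˡ_ (PD-prefix V V≢[]) (PD-prefix U U≢[]) Vᵢ<Uᵢ))
  where
  PD-prefix : ∀ X → X ≢ [] → PD (omegaPrefix X i) ≡ take i (PD (omegaPrefix X j))
  PD-prefix X X≢[] = trans (cong PD (sym (omegaPrefix-take X X≢[] i≤j))) (PD-take i (omegaPrefix X j))
  length-PD : ∀ X → X ≢ [] → length (PD (omegaPrefix X j)) ≡ j
  length-PD X X≢[] = trans (length-pdGo [] (omegaPrefix X j)) (length-omegaPrefix X j X≢[])
  same-length : length (PD (omegaPrefix V j)) ≡ length (PD (omegaPrefix U j))
  same-length = trans (length-PD V V≢[]) (sym (length-PD U U≢[]))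

-- The strict halves of ⪯ω are asymmetric, so V =ω U can only hold through the root clause.
=ω⇒root-RPD≡ : ∀ {V U} → V ≢ [] → U ≢ [] → V =ω U → root (RPD V) ≡ root (RPD U)
=ω⇒root-RPD≡ _ _ (inj₂ same-root , _) = same-root
=ω⇒root-RPD≡ _ _ (inj₁ _ , inj₂ same-root) = sym same-root
=ω⇒root-RPD≡ V≢[] U≢[] (inj₁ (i , V<U) , inj₁ (j , U<V)) with ≤-total i j
... | inj₁ i≤j = contradiction U<V (PD-omegaPrefix-asym V≢[] U≢[] i≤j V<U)
... | inj₂ j≤i = contradiction V<U (PD-omegaPrefix-asym U≢[] V≢[] j≤i U<V)

-- Rotation periods

period : List Sym → ℕ
period t = length (root (RPD t))

RPD-≢[] : ∀ {t} → t ≢ [] → RPD t ≢ []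
RPD-≢[] {t} t≢[] eq = t≢[] (length≡0⇒≡[] (trans (sym (length-RPD t)) (cong length eq)))

period-nonZero : ∀ {t} → t ≢ [] → NonZero (period t)
period-nonZero t≢[] = root-nonZero (RPD-≢[] t≢[])

period∣length : ∀ t → period t ∣ length t
period∣length t with k , eq ← root-pow (RPD t) =
  divides k (trans (sym (length-RPD t)) (trans (cong length (sym eq)) (length-pow (root (RPD t)) k)))

∣period⇒=ω : ∀ t {o} → period t ∣ o → rotN o t =ω t
∣period⇒=ω t {o} (divides q refl) = inj₂ same-root , inj₂ (sym same-root)
  where
  same-root : root (RPD (rotN o t)) ≡ root (RPD t)
  same-root = cong root (trans (RPD-rotN o t) (rotN-*-fixed (period t) (RPD t) (rotN-root (RPD t)) q))

=ω⇒∣period : ∀ t o → t ≢ [] → rotN o t =ω t → period t ∣ o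
=ω⇒∣period t o t≢[] o≈ = root-rotN≡⇒∣ (RPD t) o (RPD-≢[] t≢[])
  (trans (cong root (sym (RPD-rotN o t))) (=ω⇒root-RPD≡ (rotN-≢[] o t≢[]) t≢[] o≈))

∣-next-≤ : ∀ {p o n} .{{_ : NonZero p}} → p ∣ o → p ∣ n → o < n → o + p ≤ n
∣-next-≤ {p} {o} {n} p∣o p∣n o<n = begin
  o + p        ≤⟨ +-monoʳ-≤ o (∣⇒≤ ⦃ >-nonZero (m<n⇒0<n∸m o<n) ⦄ p∣n∸o) ⟩
  o + (n ∸ o)  ≡⟨ m+[n∸m]≡n (<⇒≤ o<n) ⟩
  n            ∎
  where
  open ≤-Reasoning
  p∣n∸o : p ∣ n ∸ o
  p∣n∸o = ∣m+n∣m⇒∣n (subst (p ∣_) (sym (m+[n∸m]≡n (<⇒≤ o<n))) p∣n) p∣o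

-- Positions in the family and prev

data Position : List (List Sym) → ℕ → Set where
  position : ∀ A t B o → o < length t → Position (A ++ t ∷ B) (totalLen A + suc o)

totalLen-++ : ∀ A B → totalLen (A ++ B) ≡ totalLen A + totalLen B
totalLen-++ A B = trans (cong sum (map-++ length A B)) (sum-++ (map length A) (map length B))

position-inRange : ∀ A t B o → o < length t → InRange (totalLen (A ++ t ∷ B)) (totalLen A + suc o)
position-inRange A t B o o<|t| =
  ≤-trans (s≤s z≤n) (m≤n+m (suc o) (totalLen A)) ,
  subst (totalLen A + suc o ≤_) (sym (totalLen-++ A (t ∷ B)))
        (+-monoʳ-≤ (totalLen A) (≤-trans o<|t| (m≤m+n (length t) (totalLen B))))

≤ᵇ-true : ∀ {m n} → m ≤ n → (m ≤ᵇ n) ≡ true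
≤ᵇ-true m≤n = Equivalence.to T-≡ (≤⇒≤ᵇ m≤n)

≤ᵇ-false : ∀ {m n} → n < m → (m ≤ᵇ n) ≡ false
≤ᵇ-false {m} {n} n<m with m ≤ᵇ n in eq
... | true  = contradiction (≤ᵇ⇒≤ m n (subst T (sym eq) tt)) (<⇒≱ n<m)
... | false = refl

private
  skip-first : ∀ a A o →
    (totalLen (a ∷ A) + suc o ≤ᵇ length a) ≡ false ×
    totalLen (a ∷ A) + suc o ∸ length a ≡ totalLen A + suc o
  skip-first a A o =
    ≤ᵇ-false (≤-<-trans (m≤m+n (length a) (totalLen A)) (m<m+n (length a + totalLen A) z<s)) ,
    trans (cong (_∸ length a) (+-assoc (length a) (totalLen A) (suc o))) (m+n∸m≡n (length a) _)

conj-position : ∀ A t B o → o < length t → conj (A ++ t ∷ B) (totalLen A + suc o) ≡ rotN o t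
conj-position []      t B o o<|t| rewrite ≤ᵇ-true o<|t| = refl
conj-position (a ∷ A) t B o o<|t| rewrite proj₁ (skip-first a A o) | proj₂ (skip-first a A o) =
  conj-position A t B o o<|t|

strOf-position : ∀ A t B o → o < length t → strOf (A ++ t ∷ B) (totalLen A + suc o) ≡ t
strOf-position []      t B o o<|t| rewrite ≤ᵇ-true o<|t| = refl
strOf-position (a ∷ A) t B o o<|t| rewrite proj₁ (skip-first a A o) | proj₂ (skip-first a A o) =
  strOf-position A t B o o<|t|

Position-∷ : ∀ {T i} t → Position T i → Position (t ∷ T) (length t + i)
Position-∷ t (position A t′ B o o<|t′|) =
  subst (Position (t ∷ A ++ t′ ∷ B)) (+-assoc (length t) (totalLen A) (suc o))
        (position (t ∷ A) t′ B o o<|t′|)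

locate : ∀ T i → InRange (totalLen T) i → Position T i
locate []       i       (1≤i , i≤0) = contradiction (≤-trans 1≤i i≤0) λ ()
locate (t ∷ ts) zero    (() , _)
locate (t ∷ ts) (suc i) (_ , i≤) with suc i ≤? length t
... | yes i<|t| = position [] t ts i i<|t|
... | no  i≮|t| = subst (Position (t ∷ ts)) (m+[n∸m]≡n |t|≤i)
                    (Position-∷ t (locate ts (suc i ∸ length t)
                      (m<n⇒0<n∸m (≰⇒> i≮|t|) , m≤n+o⇒m∸n≤o (suc i) (length t) i≤)))
  where
  |t|≤i : length t ≤ suc i
  |t|≤i = <⇒≤ (≰⇒> i≮|t|)

≢[]-of-< : ∀ {A : Set} {o} {t : List A} → o < length t → t ≢ []
≢[]-of-< o<0 refl = contradiction o<0 λ ()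

module _ (A : List (List Sym)) (t : List Sym) (B : List (List Sym)) {prev : ℕ → ℕ}
         (spec : PrevSpec (A ++ t ∷ B) prev) where

  private
    i-∸1 : ∀ o → totalLen A + suc o ∸ 1 ≡ totalLen A + o
    i-∸1 o = cong (_∸ 1) (+-suc (totalLen A) o)

  prev-on-period : ∀ o → o < length t → period t ∣ o →
                   prev (totalLen A + suc o) ≡ totalLen A + (o + period t)
  prev-on-period o o<|t| p∣o = begin
    prev (totalLen A + suc o)
      ≡⟨ proj₁ (spec _ (position-inRange A t B o o<|t|)) ω-equal ⟩
    totalLen A + suc o ∸ 1 + period (strOf (A ++ t ∷ B) (totalLen A + suc o))
      ≡⟨ cong₂ _+_ (i-∸1 o) (cong period (strOf-position A t B o o<|t|)) ⟩
    totalLen A + o + period t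
      ≡⟨ +-assoc (totalLen A) o (period t) ⟩
    totalLen A + (o + period t) ∎
    where
    open ≡-Reasoning
    ω-equal : conj (A ++ t ∷ B) (totalLen A + suc o) =ω strOf (A ++ t ∷ B) (totalLen A + suc o)
    ω-equal = subst₂ _=ω_ (sym (conj-position A t B o o<|t|)) (sym (strOf-position A t B o o<|t|))
                          (∣period⇒=ω t p∣o)

  prev-off-period : ∀ o → o < length t → ¬ period t ∣ o → prev (totalLen A + suc o) ≡ totalLen A + o
  prev-off-period o o<|t| p∤o =
    trans (proj₂ (spec _ (position-inRange A t B o o<|t|)) ω-distinct) (i-∸1 o)
    where
    ω-distinct : ¬ conj (A ++ t ∷ B) (totalLen A + suc o) =ω strOf (A ++ t ∷ B) (totalLen A + suc o)
    ω-distinct o≈ = p∤o (=ω⇒∣period t o (≢[]-of-< o<|t|)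
      (subst₂ _=ω_ (conj-position A t B o o<|t|) (strOf-position A t B o o<|t|) o≈))

  -- Within each block of length p = period t, prev cycles the offsets backwards,
  -- and rotation by p fixes RPD(t).
  prev-predecessor : ∀ o → o < length t →
    ∃[ o′ ] o′ < length t × prev (totalLen A + suc o) ≡ totalLen A + suc o′
                          × rotN (suc o′) (RPD t) ≡ rotN o (RPD t)
  prev-predecessor o o<|t| with period t ∣? o
  prev-predecessor o o<|t| | yes p∣o =
    o + pred p , o′<|t| ,
    trans (prev-on-period o o<|t| p∣o) (cong (totalLen A +_) (sym 1+o′≡o+p)) , rotations
    where
    p = period t
    instance _ = period-nonZero {t} (≢[]-of-< {t = t} o<|t|)
    1+o′≡o+p : suc (o + pred p) ≡ o + p
    1+o′≡o+p = trans (sym (+-suc o (pred p))) (cong (o +_) (suc-pred p))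
    o′<|t| : o + pred p < length t
    o′<|t| = subst (_≤ length t) (sym 1+o′≡o+p) (∣-next-≤ p∣o (period∣length t) o<|t|)
    rotations : rotN (suc (o + pred p)) (RPD t) ≡ rotN o (RPD t)
    rotations = trans (cong (λ k → rotN k (RPD t)) 1+o′≡o+p)
                      (trans (rotN-+ o p (RPD t)) (cong (rotN o) (rotN-root (RPD t))))
  prev-predecessor zero    _     | no p∤0 = contradiction (period t ∣0) p∤0
  prev-predecessor (suc o) o<|t| | no p∤o =
    o , <⇒≤ o<|t| , prev-off-period (suc o) o<|t| p∤o , refl

  prev-hits : ∀ o → o < length t → ∃[ c ] c < length t × prev (totalLen A + suc c) ≡ totalLen A + suc o
  prev-hits o o<|t| with period t ∣? suc o
  ... | yes (divides (suc q) 1+o≡) =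
    q * period t , c<|t| ,
    trans (prev-on-period (q * period t) c<|t| (n∣m*n q))
          (cong (totalLen A +_) (trans (+-comm (q * period t) (period t)) (sym 1+o≡)))
    where
    instance _ = period-nonZero {t} (≢[]-of-< {t = t} o<|t|)
    c<|t| : q * period t < length t
    c<|t| = <-≤-trans (subst (q * period t <_) (sym 1+o≡) (m<n+m (q * period t) (>-nonZero⁻¹ (period t))))
                      o<|t|
  ... | no p∤1+o = suc o , 1+o<|t| , prev-off-period (suc o) 1+o<|t| p∤1+o
    where
    1+o<|t| : suc o < length t
    1+o<|t| = ≤∧≢⇒< o<|t| λ 1+o≡|t| → p∤1+o (subst (period t ∣_) (sym 1+o≡|t|) (period∣length t))

prev-π≡RTS-last : ∀ {T prev j} → PrevSpec T prev → Position T j →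
  InRange (totalLen T) (prev j) × π (conj T (prev j)) ≡ RTS (conj T j) (length (conj T j))
prev-π≡RTS-last {prev = prev} spec (position A t B o o<|t|)
  with o′ , o′<|t| , prev≡ , rotations ← prev-predecessor A t B spec o o<|t| =
  subst (InRange _) (sym prev≡) (position-inRange A t B o′ o′<|t|) , (begin
    π (conj 𝒯 (prev (totalLen A + suc o)))   ≡⟨ cong (π ∘ conj 𝒯) prev≡ ⟩
    π (conj 𝒯 (totalLen A + suc o′))         ≡⟨ cong π (conj-position A t B o′ o′<|t|) ⟩
    π (rotN o′ t)                            ≡⟨ π≡lastRTS-rot (rotN o′ t) (rotN-≢[] o′ t≢[]) ⟩
    lastRTS (RPD (rotN (suc o′) t))          ≡⟨ cong lastRTS (trans (RPD-rotN (suc o′) t) rotations) ⟩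
    lastRTS (rotN o (RPD t))                 ≡⟨ cong lastRTS (RPD-rotN o t) ⟨
    lastRTS (RPD (rotN o t))                 ≡⟨ RTS-last (rotN o t) (rotN-≢[] o t≢[]) ⟨
    RTS (rotN o t) (length (rotN o t))       ≡⟨ cong (λ V → RTS V (length V)) (conj-position A t B o o<|t|) ⟨
    RTS (conj 𝒯 (totalLen A + suc o)) (length (conj 𝒯 (totalLen A + suc o))) ∎)
  where
  open ≡-Reasoning
  𝒯 = A ++ t ∷ B
  t≢[] : t ≢ []
  t≢[] = ≢[]-of-< o<|t|

prev-surjective : ∀ {T prev j} → PrevSpec T prev → Position T j →
                  ∃[ c ] InRange (totalLen T) c × prev c ≡ j
prev-surjective spec (position A t B o o<|t|) with c , c<|t| , prev≡ ← prev-hits A t B spec o o<|t| =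
  totalLen A + suc c , position-inRange A t B c c<|t| , prev≡

module _ {n : ℕ} {CA ICA : ℕ → ℕ} (spec : ICASpec n CA ICA) where

  CA∘ICA : ∀ {c} → InRange n c → CA (ICA c) ≡ c
  CA∘ICA {c} c∈ = Equivalence.to (proj₂ spec (ICA c) c (proj₁ spec c c∈) c∈) refl

  ICA∘CA : ∀ {i} → InRange n i → InRange n (CA i) → ICA (CA i) ≡ i
  ICA∘CA i∈ CAi∈ = Equivalence.from (proj₂ spec _ _ i∈ CAi∈) refl

LF-surjective : ∀ {T CA ICA prev} → CASpec T CA → ICASpec (totalLen T) CA ICA → PrevSpec T prev →
  ∀ i → InRange (totalLen T) i → ∃[ i′ ] InRange (totalLen T) i′ × LF CA ICA prev i′ ≡ i
LF-surjective {T} {CA} {ICA} {prev} (CA∈ , _) icaSpec prevSpec i i∈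
  with c , c∈ , prev-c≡ ← prev-surjective prevSpec (locate T (CA i) (CA∈ i i∈)) =
  ICA c , proj₁ icaSpec c c∈ , (begin
    ICA (prev (CA (ICA c)))   ≡⟨ cong (ICA ∘ prev) (CA∘ICA icaSpec c∈) ⟩
    ICA (prev c)              ≡⟨ cong ICA prev-c≡ ⟩
    ICA (CA i)                ≡⟨ ICA∘CA icaSpec i∈ (CA∈ i i∈) ⟩
    i                         ∎)
  where open ≡-Reasoning

F-on-image-of-LF : ∀ {T CA ICA prev} {F : ℕ → RSym} →
  (∀ i → InRange (totalLen T) i → F (LF CA ICA prev i) ≡ Lt T CA ICA prev i) →
  ∀ {i i′} → InRange (totalLen T) i′ → LF CA ICA prev i′ ≡ i → F i ≡ π (conj T (CA i))
F-on-image-of-LF F∘LF i′∈ refl = F∘LF _ i′∈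

corollary30 : (σ : ℕ) (T : List (List Sym)) →
    T ≢ [] →
    All (λ t → (t ≢ []) × All (InΣ$ σ) t) T →
    (CA ICA prev : ℕ → ℕ) (F : ℕ → RSym) →
    CASpec T CA →
    ICASpec (totalLen T) CA ICA →
    PrevSpec T prev →
    (∀ i → InRange (totalLen T) i → F (LF CA ICA prev i) ≡ Lt T CA ICA prev i) →
    ∀ i → InRange (totalLen T) i →
      (F i ≡ π (conj T (CA i))) ×
      (Lt T CA ICA prev i ≡ RTS (conj T (CA i)) (length (conj T (CA i))))
corollary30 σ T _ _ CA ICA prev F caSpec icaSpec prevSpec F∘LF i i∈ = F-value , L-value
  where
  prev-of-CAi : InRange (totalLen T) (prev (CA i)) ×
                π (conj T (prev (CA i))) ≡ RTS (conj T (CA i)) (length (conj T (CA i)))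
  prev-of-CAi = prev-π≡RTS-last prevSpec (locate T (CA i) (proj₁ caSpec i i∈))
  L-value : Lt T CA ICA prev i ≡ RTS (conj T (CA i)) (length (conj T (CA i)))
  L-value = trans (cong (π ∘ conj T) (CA∘ICA icaSpec (proj₁ prev-of-CAi))) (proj₂ prev-of-CAi)
  F-value : F i ≡ π (conj T (CA i))
  F-value with i′ , i′∈ , LF≡ ← LF-surjective {T} {CA} {ICA} {prev} caSpec icaSpec prevSpec i i∈ =
    F-on-image-of-LF {T} {CA} {ICA} {prev} {F} F∘LF i′∈ LF≡
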